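{- Let $k\geq 1$ be an integer. For every finite sequence $X=(x_0,\dots,x_{n-1})$ of pairwise distinct integers (a permutation), the result of applying the procedure Schensted-HEAP$_k$ to $X$ is a $k$-heap tableau.
   Context: Let $\Sigma_k=\{1,\dots,k\}$; $q\sqsubset r$ means $q$ is a proper prefix of $r$. A $k$-heap tableau is a function $T:\Sigma_{k}^{*}\times\{1,2,\dots\}\to\mathbf{N}\cup\{\perp\}$ (integer values) with (a) finite domain $dom(T)=\{(r,a):T(r,a)\neq\perp\}$; (b) if $T(r,a)\neq\perp$ and $q\sqsubset r$ then $T(q,a)\neq\perp$ and $T(q,a)\leq T(r,a)$; (c) if $T(r,a)\neq\perp$ and $b<a$ then $T(r,b)\neq\perp$ and $T(r,b)<T(r,a)$. Write $V_r=(T(r,1),T(r,2),\dots)$ for the (increasing, possibly empty) vector at address $r$. Procedure Schensted-HEAP$_k$: start from the empty tableau and, for $i=0,\dots,n-1$, call BUMP$(x_i,\{\lambda\})$, where $\lambda$ is the empty word. BUMP$(x,S)$, for a set $S$ of addresses: consider the addresses $r\in S$ in order (for $S=r'\cdot\Sigma_k$, the order $r'1,r'2,\dots,r'k$); if for some $r\in S$ appending $x$ at the end of $V_r$ keeps $V_r$ increasing (in particular if $V_r$ is empty, in which case the vector is created), append $x$ to $V_r$ for the first such $r$. Otherwise let $B_x$ be the set of elements greater than $x$ in the vectors $V_r$, $r\in S$, let $y=\min B_x$ and $r$ the address of the vector containing $y$, replace $y$ by $x$ in $V_r$, and call BUMP$(y, r\cdot\Sigma_k)$, where $r\cdot\Sigma_k=\{r1,\dots,rk\}$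 are the children of $r$. -}

module Defs where

open import Data.Nat using (ℕ; zero; suc)
import Data.Nat as ℕ
open import Data.Integer using (ℤ; _<_; _≤_; _<?_)
open import Data.Fin using (Fin)
import Data.Fin as Fin
open import Data.List using (List; []; _∷_; _++_; [_]; map; concatMap; length)
open import Data.List.Properties using (≡-dec)
open import Data.List.Relation.Unary.Linked using (Linked)
open import Data.List.Relation.Unary.Linked.Properties using ()
import Data.List.Relation.Unary.Linked as Linked
open import Data.List.Relation.Unary.AllPairs using (AllPairs)
open import Data.List.Membership.Propositional using (_∈_)
open import Data.Vec using (allFin) renaming (toList to vtoList)
open import Data.Maybe using (Maybe; just; nothing; _>>=_)
open import Data.Product using (_×_; _,_; Σ; ∃)
open import Relation.Binary.PropositionalEquality using (_≡_; _≢_)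
open import Relation.Nullary using (yes; no; ¬_)
import Data.Integer.Properties as ℤP

-- Addresses: words over Σ_k = {1,…,k}, represented by Fin k
-- (Fin.zero ↦ 1, …, Fin.fromℕ (k-1) ↦ k).  The empty word is λ = [].

Addr : ℕ → Set
Addr k = List (Fin k)

_⊏_ : ∀ {k} → Addr k → Addr k → Set
q ⊏ r = ∃ λ s → (s ≢ []) × (q ++ s ≡ r)

children : ∀ {k} → Addr k → List (Addr k)
children {k} r = map (λ i → r ++ [ i ]) (vtoList (allFin k))

-- k-heap tableaux.  T r a = nothing means T(r,a) = ⊥.  Only arguments
-- a ≥ 1 are meaningful (the second argument ranges over {1,2,…}).

Tableau : ℕ → Set
Tableau k = Addr k → ℕ → Maybe ℤ

record IsHeapTableau {k : ℕ} (T : Tableau k) : Set where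
  field
    finiteDom : ∃ λ (D : List (Addr k × ℕ)) →
      ∀ r a → 1 ℕ.≤ a → T r a ≢ nothing → (r , a) ∈ D
    heap : ∀ q r a v → 1 ℕ.≤ a → T r a ≡ just v → q ⊏ r →
      ∃ λ u → (T q a ≡ just u) × (u ≤ v)
    row : ∀ r a b v → 1 ℕ.≤ b → b ℕ.< a → T r a ≡ just v →
      ∃ λ u → (T r b ≡ just u) × (u < v)

-- The procedure.  A store assigns to each address its vector V_r
-- (a list, [] = empty vector).

Store : ℕ → Set
Store k = Addr k → List ℤ

emptyStore : ∀ {k} → Store k
emptyStore _ = []

update : ∀ {k} → Store k → Addr k → List ℤ → Store k
update V r w q with ≡-dec Fin._≟_ q r
... | yes _ = w
... | no  _ = V q

appendable : List ℤ → ℤ → Set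
appendable V x = Linked _<_ (V ++ [ x ])

appendable? : ∀ V x → Relation.Nullary.Dec (appendable V x)
appendable? V x = Linked.linked? _<?_ (V ++ [ x ])
  where import Relation.Nullary

firstAppendable : ∀ {k} → Store k → ℤ → List (Addr k) → Maybe (Addr k)
firstAppendable V x [] = nothing
firstAppendable V x (r ∷ S) with appendable? (V r) x
... | yes _ = just r
... | no  _ = firstAppendable V x S

minAbove : ∀ {k} → ℤ → List (Addr k × ℤ) → Maybe (Addr k × ℤ)
minAbove x [] = nothing
minAbove x ((r , y) ∷ ps) with x <? y | minAbove x ps
... | no  _ | m = m
... | yes _ | nothing = just (r , y)
... | yes _ | just (r' , y') with y <? y'
...   | yes _ = just (r , y)
...   | no  _ = just (r' , y')

replace : ℤ → ℤ → List ℤ → List ℤ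
replace y x [] = []
replace y x (z ∷ zs) with ℤP._≟_ z y
... | yes _ = x ∷ replace y x zs
... | no  _ = z ∷ replace y x zs

-- BUMP(x, S), with a fuel argument bounding the number of recursive
-- calls; nothing = fuel exhausted (or B_x empty, which cannot happen
-- for distinct inputs).
bump : ∀ {k} → ℕ → ℤ → List (Addr k) → Store k → Maybe (Store k)
bump zero x S V = nothing
bump (suc f) x S V with firstAppendable V x S
... | just r  = just (update V r (V r ++ [ x ]))
... | nothing with minAbove x (concatMap (λ r → map (r ,_) (V r)) S)
...   | nothing      = nothing
...   | just (r , y) = bump f y (children r) (update V r (replace y x (V r)))

-- Insert x_i, x_{i+1}, … ; before inserting x_i the store holds i
-- elements, so any bump chain makes at most i+1 calls: fuel suc i
-- is always sufficient.
run : ∀ {k} → ℕ → List ℤ → Store k → Maybe (Store k)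
run i [] V = just V
run i (x ∷ xs) V = bump (suc i) x [ [] ] V >>= run (suc i) xs

schenstedHeap : (k : ℕ) → List ℤ → Maybe (Store k)
schenstedHeap k X = run 0 X emptyStore

-- the tableau T with V_r = (T(r,1), T(r,2), …)
nth : List ℤ → ℕ → Maybe ℤ
nth [] _ = nothing
nth (z ∷ zs) zero = just z
nth (z ∷ zs) (suc n) = nth zs n

toTableau : ∀ {k} → Store k → Tableau k
toTableau V r zero = nothing
toTableau V r (suc a) = nth (V r) a

Distinct : List ℤ → Set
Distinct = AllPairs _≢_

module Submission where

-- We show that the procedure
-- never fails and preserves an invariant (HeapStore) from which the three
-- tableau axioms are read off.  After i insertions: rows are increasing, a
-- value lies in at most one row, nonempty rows have depth < i and all rows
-- length ≤ i (finite domain, and enough fuel for BUMP), and every row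
-- supports each child row: the child is no longer and entrywise above it.
-- The heart is supports-append and supports-bump: if x bumps y = min B_x out
-- of a parent row, then appending y to a child row, or letting y bump the
-- least entry above y out of it, keeps that child supported.  Inside a bump
-- chain the invariant fails only below the row just changed, whose children
-- are still supported by its old contents (Bumping); each step moves this
-- defect one level down.

open import Defs
open import Data.Nat as ℕ using (ℕ; zero; suc; _+_; s≤s; z≤n)
import Data.Nat.Properties as ℕP
open import Data.Integer using (ℤ; _<_; _≤_; _<?_)
import Data.Integer.Properties as ℤP
open import Data.Fin using (Fin)
import Data.Fin as Fin
open import Data.List
  using (List; []; _∷_; _++_; [_]; length; map; concatMap; upTo; allFin; cartesianProduct; cartesianProductWith)
open import Data.List.Properties using (≡-dec; ∷ʳ-injective; length-++; ++-conicalʳ; ++-identityʳ; ++-assoc)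
open import Data.List.Relation.Unary.All using (All; []; _∷_)
import Data.List.Relation.Unary.All as All
open import Data.List.Relation.Unary.All.Properties using (¬All⇒Any¬)
open import Data.List.Relation.Unary.Any using (Any; here; there)
import Data.List.Relation.Unary.Any as Any
open import Data.List.Relation.Unary.AllPairs using (AllPairs; []; _∷_; tail)
import Data.List.Relation.Unary.AllPairs.Properties as AllPairs
open import Data.List.Relation.Unary.Linked.Properties using (Linked⇒AllPairs; AllPairs⇒Linked)
open import Data.List.Membership.Propositional using (_∈_; _∉_; find)
open import Data.List.Membership.Propositional.Properties
  using (∈-map⁺; ∈-map⁻; ∈-concatMap⁺; ∈-concatMap⁻; ∈-++⁺ˡ; ∈-++⁺ʳ; ∈-++⁻; ∈-allFin; ∈-upTo⁺;
         ∈-cartesianProduct⁺; ∈-cartesianProductWith⁺)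
open import Data.Vec.Membership.Propositional.Properties using (∈-toList⁺; ∈-allFin⁺)
open import Data.Maybe using (just; nothing; _>>=_)
open import Data.Product using (_×_; _,_; ∃; proj₁; proj₂)
import Data.Product as Product
open import Data.Sum using (_⊎_; inj₁; inj₂)
import Data.Sum as Sum
open import Data.Empty using (⊥-elim)
open import Function using (_∘_; case_of_)
open import Relation.Binary.PropositionalEquality
  using (_≡_; _≢_; refl; sym; trans; cong; subst; subst₂)
open import Relation.Nullary using (Dec; yes; no; ¬_)


Increasing : List ℤ → Set
Increasing = AllPairs _<_

record LeastAbove (x y : ℤ) (W : List ℤ) : Set where
  field
    member : y ∈ W
    above  : x < y
    least  : ∀ {w} → w ∈ W → x < w → y ≤ w
open LeastAbove

∈-tail : ∀ {A : Set} {y w : A} {W} → y ∈ w ∷ W → w ≢ y → y ∈ W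
∈-tail (here refl) w≢y = ⊥-elim (w≢y refl)
∈-tail (there y∈W) _   = y∈W

head<tail : ∀ {w y W} → Increasing (w ∷ W) → y ∈ W → w < y
head<tail (w<W ∷ _) = All.lookup w<W

head∉tail : ∀ {w W} → Increasing (w ∷ W) → w ∉ W
head∉tail inc w∈W = ℤP.<-irrefl refl (head<tail inc w∈W)

head≤ : ∀ {w y W} → Increasing (w ∷ W) → y ∈ w ∷ W → w ≤ y
head≤ inc (here refl) = ℤP.≤-refl
head≤ inc (there y∈W) = ℤP.<⇒≤ (head<tail inc y∈W)

least-tail : ∀ {x y w W} → LeastAbove x y (w ∷ W) → w ≢ y → LeastAbove x y W
least-tail l w≢y = record
  { member = ∈-tail (member l) w≢y ; above = above l ; least = least l ∘ there }

below-least : ∀ {x y w W} → LeastAbove x y W → w ∈ W → w < y → w ≢ x → w < x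
below-least {x} {y} {w} l w∈W w<y w≢x with x <? w
... | yes x<w = ⊥-elim (ℤP.<-irrefl refl (ℤP.<-≤-trans w<y (least l w∈W x<w)))
... | no  x≮w = ℤP.≤∧≢⇒< (ℤP.≮⇒≥ x≮w) w≢x

replace-∈⁻ : ∀ {y x e} W → e ∈ replace y x W → e ≡ x ⊎ e ∈ W
replace-∈⁻ {y} (w ∷ W) e∈ with ℤP._≟_ w y | e∈
... | yes _ | here refl = inj₁ refl
... | yes _ | there e∈′ = Sum.map₂ there (replace-∈⁻ W e∈′)
... | no _  | here refl = inj₂ (here refl)
... | no _  | there e∈′ = Sum.map₂ there (replace-∈⁻ W e∈′)

replace-∈⁺ : ∀ {y x} W → y ∈ W → x ∈ replace y x W
replace-∈⁺ {y} (w ∷ W) y∈ with ℤP._≟_ w y | y∈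
... | yes _   | _         = here refl
... | no w≢y  | here refl = ⊥-elim (w≢y refl)
... | no _    | there y∈′ = there (replace-∈⁺ W y∈′)

replace-removes : ∀ {y x} W → x ≢ y → y ∉ replace y x W
replace-removes {y} (w ∷ W) x≢y y∈ with ℤP._≟_ w y | y∈
... | yes _   | here refl = x≢y refl
... | yes _   | there y∈′ = replace-removes W x≢y y∈′
... | no w≢y  | here refl = w≢y refl
... | no _    | there y∈′ = replace-removes W x≢y y∈′

replace-absent : ∀ {y x} W → y ∉ W → replace y x W ≡ W
replace-absent [] _ = refl
replace-absent {y} (w ∷ W) y∉ with ℤP._≟_ w y
... | yes refl = ⊥-elim (y∉ (here refl))
... | no _     = cong (w ∷_) (replace-absent W (y∉ ∘ there))

replace-length : ∀ {y x} W → length (replace y x W) ≡ length W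
replace-length [] = refl
replace-length {y} (w ∷ W) with ℤP._≟_ w y
... | yes _ = cong suc (replace-length W)
... | no _  = cong suc (replace-length W)

replace-increasing : ∀ {x y} W → Increasing W → LeastAbove x y W → x ∉ W →
  Increasing (replace y x W)
replace-increasing {x} {y} (w ∷ W) inc@(w<W ∷ incW) l x∉ with ℤP._≟_ w y
... | yes refl = subst (λ t → Increasing (x ∷ t)) (sym (replace-absent W (head∉tail inc)))
                   (All.map (ℤP.<-trans (above l)) w<W ∷ incW)
... | no w≢y = All.tabulate head<rest ∷ replace-increasing W incW l′ (x∉ ∘ there)
  where
  l′ = least-tail l w≢y
  head<rest : ∀ {e} → e ∈ replace y x W → w < e
  head<rest e∈ with replace-∈⁻ W e∈
  ... | inj₁ refl = below-least l (here refl) (All.lookup w<W (member l′)) (λ w≡x → x∉ (here (sym w≡x)))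
  ... | inj₂ e∈W  = All.lookup w<W e∈W

appendable⇒below : ∀ W {y} → appendable W y → All (_< y) W
appendable⇒below W app = go W (Linked⇒AllPairs ℤP.<-trans app)
  where
  go : ∀ W {y} → Increasing (W ++ [ y ]) → All (_< y) W
  go []      _           = []
  go (w ∷ W) (w<W ∷ inc) = All.lookup w<W (∈-++⁺ʳ W (here refl)) ∷ go W inc

below⇒appendable : ∀ {W y} → Increasing W → All (_< y) W → appendable W y
below⇒appendable {W} inc W<y =
  AllPairs⇒Linked (AllPairs.++⁺ inc ([] ∷ []) (All.map (_∷ []) W<y))


-- Supports P W: the child row W is no longer than the parent row P and
-- lies entrywise above it; this is condition (b) for one edge of the tree.
data Supports : List ℤ → List ℤ → Set where
  []  : ∀ {P} → Supports P []
  _∷_ : ∀ {p P w W} → p ≤ w → Supports P W → Supports (p ∷ P) (w ∷ W)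

supports-lower : ∀ {x y W} P → x ≤ y → Supports P W → Supports (replace y x P) W
supports-lower _ _ [] = []
supports-lower {y = y} (p ∷ P) x≤y (p≤w ∷ s) with ℤP._≟_ p y
... | yes refl = ℤP.≤-trans x≤y p≤w ∷ supports-lower P x≤y s
... | no _     = p≤w ∷ supports-lower P x≤y s

supports-extend : ∀ {P W x} → Supports P W → Supports (P ++ [ x ]) W
supports-extend []      = []
supports-extend (p≤w ∷ s) = p≤w ∷ supports-extend s

supports-bumped-head : ∀ {x y W} p P → Increasing (p ∷ P) → y ∈ p ∷ P → x < y →
  Supports P W → Supports (replace y x (p ∷ P)) (y ∷ W)
supports-bumped-head {x} {y} p P inc y∈ x<y s with ℤP._≟_ p y
... | yes _ = ℤP.<⇒≤ x<y ∷ supports-lower P (ℤP.<⇒≤ x<y) s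
... | no _  = head≤ inc y∈ ∷ supports-lower P (ℤP.<⇒≤ x<y) s

supports-append : ∀ {x y} P W → Increasing P → y ∈ P → x < y →
  Supports P W → All (_< y) W → Supports (replace y x P) (W ++ [ y ])
supports-append (p ∷ P) [] inc y∈ x<y [] [] = supports-bumped-head p P inc y∈ x<y []
supports-append {y = y} (p ∷ P) (w ∷ W) (_ ∷ inc) y∈ x<y (p≤w ∷ s) (w<y ∷ W<y) with ℤP._≟_ p y
... | yes refl = ⊥-elim (ℤP.<-irrefl refl (ℤP.≤-<-trans p≤w w<y))
... | no p≢y   = p≤w ∷ supports-append P W inc (∈-tail y∈ p≢y) x<y s W<y

supports-bump : ∀ {x y z} P W → Increasing P → y ∈ P → x < y →
  Increasing W → LeastAbove y z W → y ∉ W → Supports P W →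
  Supports (replace y x P) (replace z y W)
supports-bump {x} {y} {z} (p ∷ P) (w ∷ W) incP y∈ x<y incW l y∉ (p≤w ∷ s) with ℤP._≟_ w z
... | yes refl = subst (λ t → Supports (replace y x (p ∷ P)) (y ∷ t))
                   (sym (replace-absent W (head∉tail incW)))
                   (supports-bumped-head p P incP y∈ x<y s)
... | no w≢z with ℤP._≟_ p y
...   | yes refl = ⊥-elim (ℤP.<-asym (head<tail incW (member l′)) z<w)
  where
  l′ = least-tail l w≢z
  z<w : z < w
  z<w = ℤP.≤∧≢⇒< (least l (here refl) (ℤP.≤∧≢⇒< p≤w (y∉ ∘ here))) (w≢z ∘ sym)
...   | no p≢y = p≤w ∷ supports-bump P W (tail incP) (∈-tail y∈ p≢y) x<y (tail incW)
                        (least-tail l w≢z) (y∉ ∘ there) s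


module _ {k : ℕ} where

  entries : Store k → List (Addr k) → List (Addr k × ℤ)
  entries V S = concatMap (λ r → map (r ,_) (V r)) S

  entries⁺ : ∀ (V : Store k) S {c z} → c ∈ S → z ∈ V c → (c , z) ∈ entries V S
  entries⁺ V S c∈ z∈ =
    ∈-concatMap⁺ (λ r → map (r ,_) (V r)) (Any.map (λ { refl → ∈-map⁺ (_ ,_) z∈ }) c∈)

  entries⁻ : ∀ (V : Store k) S {c z} → (c , z) ∈ entries V S → c ∈ S × z ∈ V c
  entries⁻ V S {c} {z} e∈ = go S (∈-concatMap⁻ (λ r → map (r ,_) (V r)) {xs = S} e∈)
    where
    go : ∀ S → Any (λ r → (c , z) ∈ map (r ,_) (V r)) S → c ∈ S × z ∈ V c
    go (r ∷ S) (here e∈r) with ∈-map⁻ (r ,_) e∈r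
    ... | _ , z∈ , refl = here refl , z∈
    go (r ∷ S) (there e∈S) = Product.map₁ there (go S e∈S)

  firstAppendable-just : ∀ (V : Store k) x S {c} → firstAppendable V x S ≡ just c →
    c ∈ S × appendable (V c) x
  firstAppendable-just V x (r ∷ S) eq with appendable? (V r) x | eq
  ... | yes app | refl = here refl , app
  ... | no _    | eq′  = Product.map₁ there (firstAppendable-just V x S eq′)

  firstAppendable-nothing : ∀ (V : Store k) x S → firstAppendable V x S ≡ nothing →
    ∀ {c} → c ∈ S → ¬ appendable (V c) x
  firstAppendable-nothing V x (r ∷ S) eq c∈ with appendable? (V r) x | eq | c∈
  ... | no ¬app | _   | here refl = ¬app
  ... | no _    | eq′ | there c∈S = firstAppendable-nothing V x S eq′ c∈S

  minAbove-nothing : ∀ x (ps : List (Addr k × ℤ)) → minAbove x ps ≡ nothing →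
    ∀ {c w} → (c , w) ∈ ps → ¬ x < w
  minAbove-nothing x ((r , y) ∷ ps) eq p∈ with x <? y | minAbove x ps in eq′
  minAbove-nothing x ((r , y) ∷ ps) eq (here refl) | no x≮y | _ = x≮y
  minAbove-nothing x ((r , y) ∷ ps) refl (there p∈) | no _ | _ = minAbove-nothing x ps eq′ p∈
  minAbove-nothing x ((r , y) ∷ ps) () p∈ | yes _ | nothing
  minAbove-nothing x ((r , y) ∷ ps) eq p∈ | yes _ | just (_ , y′) with y <? y′
  minAbove-nothing x ((r , y) ∷ ps) () p∈ | yes _ | just _ | yes _
  minAbove-nothing x ((r , y) ∷ ps) () p∈ | yes _ | just _ | no _

  record MinAbove (x : ℤ) (ps : List (Addr k × ℤ)) (c : Addr k) (z : ℤ) : Set where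
    field
      found   : (c , z) ∈ ps
      aboveX  : x < z
      minimal : ∀ {c′ w} → (c′ , w) ∈ ps → x < w → z ≤ w
  open MinAbove

  minAbove-just : ∀ x (ps : List (Addr k × ℤ)) {c z} → minAbove x ps ≡ just (c , z) → MinAbove x ps c z
  minAbove-just x ((r , y) ∷ ps) eq with x <? y | minAbove x ps in eq′
  minAbove-just x ((r , y) ∷ ps) refl | no x≮y | just _ = record
    { found = there (found m) ; aboveX = aboveX m
    ; minimal = λ { (here refl) x<w → ⊥-elim (x≮y x<w) ; (there p∈) → minimal m p∈ } }
    where m = minAbove-just x ps eq′
  minAbove-just x ((r , y) ∷ ps) refl | yes x<y | nothing = record
    { found = here refl ; aboveX = x<y
    ; minimal = λ { (here refl) _ → ℤP.≤-refl
                  ; (there p∈) x<w → ⊥-elim (minAbove-nothing x ps eq′ p∈ x<w) } }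
  minAbove-just x ((r , y) ∷ ps) eq | yes x<y | just (r′ , y′) with y <? y′ | minAbove-just x ps eq′
  ... | yes y<y′ | m with eq
  ...   | refl = record
    { found = here refl ; aboveX = x<y
    ; minimal = λ { (here refl) _ → ℤP.≤-refl
                  ; (there p∈) x<w → ℤP.≤-trans (ℤP.<⇒≤ y<y′) (minimal m p∈ x<w) } }
  minAbove-just x ((r , y) ∷ ps) refl | yes x<y | just (r′ , y′) | no y≮y′ | m = record
    { found = there (found m) ; aboveX = aboveX m
    ; minimal = λ { (here refl) _ → ℤP.≮⇒≥ y≮y′ ; (there p∈) → minimal m p∈ } }

  -- A row that does not admit a fresh value x has an entry above x, so
  -- B_x is nonempty whenever BUMP cannot append.
  blocked⇒above : ∀ {x W} → Increasing W → ¬ appendable W x → x ∉ W → ∃ λ w → w ∈ W × x < w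
  blocked⇒above {x} {W} inc ¬app x∉ with find (¬All⇒Any¬ (_<? x) W (¬app ∘ below⇒appendable inc))
  ... | w , w∈ , w≮x = w , w∈ , ℤP.≤∧≢⇒< (ℤP.≮⇒≥ w≮x) (λ x≡w → x∉ (subst (_∈ W) (sym x≡w) w∈))

  bump-appends : ∀ f x S (V : Store k) {c} → firstAppendable V x S ≡ just c →
    bump (suc f) x S V ≡ just (update V c (V c ++ [ x ]))
  bump-appends f x S V eqF rewrite eqF = refl

  bump-bumps : ∀ f x S (V : Store k) {c y} → firstAppendable V x S ≡ nothing →
    minAbove x (entries V S) ≡ just (c , y) →
    bump (suc f) x S V ≡ bump f y (children c) (update V c (replace y x (V c)))
  bump-bumps f x S V eqF eqM rewrite eqF | eqM = refl

  data BumpStep (f : ℕ) (x : ℤ) (S : List (Addr k)) (V : Store k) : Set where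
    appended : ∀ c → c ∈ S → appendable (V c) x →
      bump (suc f) x S V ≡ just (update V c (V c ++ [ x ])) → BumpStep f x S V
    bumped : ∀ c y → c ∈ S → LeastAbove x y (V c) →
      bump (suc f) x S V ≡ bump f y (children c) (update V c (replace y x (V c))) → BumpStep f x S V

  bump-step : ∀ f x S (V : Store k) {c₀} → c₀ ∈ S →
    (∀ r → Increasing (V r)) → (∀ r → x ∉ V r) → BumpStep f x S V
  bump-step f x S V c₀∈ inc fresh with firstAppendable V x S in eqF
  ... | just c = appended c (proj₁ spec) (proj₂ spec) (bump-appends f x S V eqF)
    where spec = firstAppendable-just V x S eqF
  ... | nothing with minAbove x (entries V S) in eqM
  ...   | just (c , y) = bumped c y (proj₁ c∈) leastAbove (bump-bumps f x S V eqF eqM)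
    where
    spec = minAbove-just x (entries V S) eqM
    c∈   = entries⁻ V S (found spec)
    leastAbove : LeastAbove x y (V c)
    leastAbove = record
      { member = proj₂ c∈ ; above = aboveX spec
      ; least  = λ w∈ → minimal spec (entries⁺ V S (proj₁ c∈) w∈) }
  ...   | nothing with blocked⇒above (inc _) (firstAppendable-nothing V x S eqF c₀∈) (fresh _)
  ...     | w , w∈ , x<w = ⊥-elim (minAbove-nothing x (entries V S) eqM (entries⁺ V S c₀∈ w∈) x<w)


length-snoc : ∀ {A : Set} (q : List A) j → length (q ++ [ j ]) ≡ suc (length q)
length-snoc q j = trans (length-++ q) (ℕP.+-comm (length q) 1)

snoc≢[] : ∀ {A : Set} (q : List A) j → q ++ [ j ] ≢ []
snoc≢[] q j eq with ++-conicalʳ q [ j ] eq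
... | ()

snoc≢self : ∀ {A : Set} (q : List A) j → q ++ [ j ] ≢ q
snoc≢self q j eq = ℕP.1+n≢n (trans (sym (length-snoc q j)) (cong length eq))

module _ {k : ℕ} where

  -- Equality of addresses, decided as in `update`.
  _≟ᴬ_ : (q r : Addr k) → Dec (q ≡ r)
  _≟ᴬ_ = ≡-dec Fin._≟_

  children⁻ : ∀ (r c : Addr k) → c ∈ children r → ∃ λ j → c ≡ r ++ [ j ]
  children⁻ r c c∈ with ∈-map⁻ (λ i → r ++ [ i ]) c∈
  ... | j , _ , c≡ = j , c≡

  children⁺ : ∀ (r : Addr k) j → r ++ [ j ] ∈ children r
  children⁺ r j = ∈-map⁺ (λ i → r ++ [ i ]) (∈-toList⁺ (∈-allFin⁺ j))

  parent-of-child : (P : Addr k → Set) → ∀ r j → P r → ∀ q j′ → q ++ [ j′ ] ≡ r ++ [ j ] → P q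
  parent-of-child P r j Pr q j′ eq with ∷ʳ-injective q r eq
  ... | refl , _ = Pr

  update-here : ∀ (V : Store k) c w → update V c w c ≡ w
  update-here V c w with c ≟ᴬ c
  ... | yes _   = refl
  ... | no c≢c = ⊥-elim (c≢c refl)

  update-elsewhere : ∀ (V : Store k) c w {q} → q ≢ c → update V c w q ≡ V q
  update-elsewhere V c w {q} q≢c with q ≟ᴬ c
  ... | yes q≡c = ⊥-elim (q≢c q≡c)
  ... | no _    = refl

  RowOnlyAdds : ℤ → List ℤ → List ℤ → Set
  RowOnlyAdds y W w = ∀ {e} → e ∈ w → e ≡ y ⊎ e ∈ W

  Supported : Store k → Set
  Supported V = ∀ q j → Supports (V q) (V (q ++ [ j ]))

  update-∈⁻ : ∀ (V : Store k) c w {y} → RowOnlyAdds y (V c) w →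
    ∀ q {e} → e ∈ update V c w q → (q ≡ c × e ≡ y) ⊎ e ∈ V q
  update-∈⁻ V c w new q e∈ with q ≟ᴬ c
  ... | yes refl = Sum.map₁ (refl ,_) (new e∈)
  ... | no _     = inj₂ e∈

  OnlyAdds : ℤ → Store k → Store k → Set
  OnlyAdds y V V′ = ∀ q {e} → e ∈ V′ q → e ≡ y ⊎ ∃ λ q′ → e ∈ V q′

  update-onlyAdds : ∀ (V : Store k) c w {y} → RowOnlyAdds y (V c) w → OnlyAdds y V (update V c w)
  update-onlyAdds V c w new q e∈ with update-∈⁻ V c w new q e∈
  ... | inj₁ (_ , e≡y) = inj₁ e≡y
  ... | inj₂ e∈V       = inj₂ (_ , e∈V)

  -- One bump step followed by the rest of the chain: the value z passed on
  -- was already stored, so overall only y is added.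
  onlyAdds-trans : ∀ {V V′ V″ : Store k} {y z c} → z ∈ V c →
    OnlyAdds y V V′ → OnlyAdds z V′ V″ → OnlyAdds y V V″
  onlyAdds-trans z∈ add′ add″ q e∈ with add″ q e∈
  ... | inj₁ refl         = inj₂ (_ , z∈)
  ... | inj₂ (q′ , e∈V′) = add′ q′ e∈V′

  supported-update-elsewhere : ∀ (V : Store k) c w →
    (∀ q j → q ++ [ j ] ≡ c → Supports (V q) w) → Supported V →
    ∀ q j → q ≢ c → Supports (update V c w q) (update V c w (q ++ [ j ]))
  supported-update-elsewhere V c w into old q j q≢c with (q ++ [ j ]) ≟ᴬ c
  ... | yes refl = subst (λ W → Supports W w) (sym (update-elsewhere V c w q≢c)) (into q j refl)
  ... | no _     = subst (λ W → Supports W (V (q ++ [ j ]))) (sym (update-elsewhere V c w q≢c)) (old q j)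

  supported-update : ∀ (V : Store k) c w → (∀ j → Supports w (V (c ++ [ j ]))) →
    (∀ q j → q ++ [ j ] ≡ c → Supports (V q) w) → Supported V → Supported (update V c w)
  supported-update V c w below into old q j = case q ≟ᴬ c of λ where
    (yes q≡c) → subst (λ q → Supports (update V c w q) (update V c w (q ++ [ j ]))) (sym q≡c)
                  (subst₂ Supports (sym (update-here V c w)) (sym (update-elsewhere V c w (snoc≢self c j))) (below j))
    (no q≢c)  → supported-update-elsewhere V c w into old q j q≢c

  ∈-snoc⁻ : ∀ {y} W → RowOnlyAdds y W (W ++ [ y ])
  ∈-snoc⁻ W e∈ with ∈-++⁻ W e∈
  ... | inj₁ e∈W        = inj₂ e∈W
  ... | inj₂ (here e≡y) = inj₁ e≡y


  record WellFormed (i : ℕ) (V : Store k) : Set where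
    field
      increasing : ∀ q → Increasing (V q)
      unique     : ∀ q q′ {z} → z ∈ V q → z ∈ V q′ → q ≡ q′
      shallow    : ∀ q {z} → z ∈ V q → length q ℕ.< i
      short      : ∀ q → length (V q) ℕ.≤ i
  open WellFormed public

  record HeapStore (i : ℕ) (V : Store k) : Set where
    field
      wellFormed : WellFormed i V
      supported  : Supported V

  -- The state inside a bump chain: x has just bumped y out of row r, whose
  -- contents before were P.  Support holds on every edge except those
  -- below r, where the children are still supported by P.
  record Bumping (i : ℕ) (V : Store k) (r : Addr k) (P : List ℤ) (x y : ℤ) : Set where
    field
      wellFormed    : WellFormed i V
      supportedElsewhere : ∀ q j → q ≢ r → Supports (V q) (V (q ++ [ j ]))
      supportedByOld : ∀ j → Supports P (V (r ++ [ j ]))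
      row≡          : V r ≡ replace y x P
      oldIncreasing : Increasing P
      bumpedFrom    : y ∈ P
      x<y           : x < y
      yFresh        : ∀ q → y ∉ V q

  module _ {i : ℕ} {V : Store k} {r : Addr k} {P : List ℤ} {x y : ℤ} (b : Bumping i V r P x y) where
    open Bumping b

    -- x now sits in row r, so r lies at depth < i.
    bumping-depth : length r ℕ.< i
    bumping-depth = shallow wellFormed r (subst (x ∈_) (sym row≡) (replace-∈⁺ P bumpedFrom))

    -- Row r only got smaller, so in fact every edge is supported.
    bumping-supported : Supported V
    bumping-supported q j with q ≟ᴬ r
    ... | yes refl = subst (λ R → Supports R (V (q ++ [ j ]))) (sym row≡)
                       (supports-lower P (ℤP.<⇒≤ x<y) (supportedByOld j))
    ... | no q≢r   = supportedElsewhere q j q≢r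

  wellFormed-update : ∀ {i i′ y} (V : Store k) c w → WellFormed i V → i ℕ.≤ i′ →
    Increasing w → RowOnlyAdds y (V c) w → (∀ q → y ∉ V q) →
    length c ℕ.< i′ → length w ℕ.≤ i′ → WellFormed i′ (update V c w)
  wellFormed-update {i′ = i′} V c w wf i≤i′ incw new fresh c<i′ w≤i′ = record
    { increasing = increasing′ ; unique = unique′ ; shallow = shallow′ ; short = short′ }
    where
    increasing′ : ∀ q → Increasing (update V c w q)
    increasing′ q with q ≟ᴬ c
    ... | yes refl = incw
    ... | no _     = increasing wf q
    unique′ : ∀ q q′ {z} → z ∈ update V c w q → z ∈ update V c w q′ → q ≡ q′
    unique′ q q′ z∈ z∈′ with update-∈⁻ V c w new q z∈ | update-∈⁻ V c w new q′ z∈′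
    ... | inj₁ (refl , _) | inj₁ (refl , _) = refl
    ... | inj₁ (_ , refl) | inj₂ z∈V       = ⊥-elim (fresh q′ z∈V)
    ... | inj₂ z∈V       | inj₁ (_ , refl) = ⊥-elim (fresh q z∈V)
    ... | inj₂ z∈V       | inj₂ z∈V′       = unique wf q q′ z∈V z∈V′
    shallow′ : ∀ q {z} → z ∈ update V c w q → length q ℕ.< i′
    shallow′ q z∈ with update-∈⁻ V c w new q z∈
    ... | inj₁ (refl , _) = c<i′
    ... | inj₂ z∈V       = ℕP.<-≤-trans (shallow wf q z∈V) i≤i′
    short′ : ∀ q → length (update V c w q) ℕ.≤ i′
    short′ q with q ≟ᴬ c
    ... | yes refl = w≤i′
    ... | no _     = ℕP.≤-trans (short wf q) i≤i′

  append-at : ∀ {i y} (V : Store k) c → WellFormed i V → Supported V → (∀ q → y ∉ V q) →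
    appendable (V c) y → length c ℕ.< suc i →
    (∀ q j → q ++ [ j ] ≡ c → Supports (V q) (V c ++ [ y ])) →
    HeapStore (suc i) (update V c (V c ++ [ y ])) × OnlyAdds y V (update V c (V c ++ [ y ]))
  append-at {i} {y} V c wf sup fresh app c<i into = record { wellFormed = wf′ ; supported = sup′ } ,
                                                  update-onlyAdds V c w (∈-snoc⁻ (V c))
    where
    w = V c ++ [ y ]
    wf′ = wellFormed-update V c w wf (ℕP.n≤1+n i) (Linked⇒AllPairs ℤP.<-trans app) (∈-snoc⁻ (V c)) fresh c<i
            (subst (ℕ._≤ suc i) (sym (length-snoc (V c) y)) (s≤s (short wf c)))
    sup′ : Supported (update V c w)
    sup′ = supported-update V c w (supports-extend ∘ sup c) into sup

  bump-at : ∀ {i y z} (V : Store k) c → WellFormed i V → Supported V → (∀ q → y ∉ V q) →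
    LeastAbove y z (V c) → (∀ q j → q ++ [ j ] ≡ c → Supports (V q) (replace z y (V c))) →
    Bumping i (update V c (replace z y (V c))) c (V c) y z × OnlyAdds y V (update V c (replace z y (V c)))
  bump-at {i} {y} {z} V c wf sup fresh l into = bumping , update-onlyAdds V c w (replace-∈⁻ (V c))
    where
    w = replace z y (V c)
    z-removed : ∀ q → z ∉ update V c w q
    z-removed q with q ≟ᴬ c
    ... | yes refl = replace-removes (V c) (ℤP.<⇒≢ (above l))
    ... | no q≢c   = λ z∈ → q≢c (unique wf q c z∈ (member l))
    bumping : Bumping i (update V c w) c (V c) y z
    bumping = record
      { wellFormed    = wellFormed-update V c w wf ℕP.≤-refl
                          (replace-increasing (V c) (increasing wf c) l (fresh c)) (replace-∈⁻ (V c)) fresh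
                          (shallow wf c (member l)) (subst (ℕ._≤ i) (sym (replace-length (V c))) (short wf c))
      ; supportedElsewhere = supported-update-elsewhere V c w into sup
      ; supportedByOld = λ j → subst (Supports (V c)) (sym (update-elsewhere V c w (snoc≢self c j))) (sup c j)
      ; row≡          = update-here V c w
      ; oldIncreasing = increasing wf c
      ; bumpedFrom    = member l
      ; x<y           = above l
      ; yFresh        = z-removed
      }

  bumping-append : ∀ {i V r P x y} → Bumping i V r P x y → ∀ j → appendable (V (r ++ [ j ])) y →
    HeapStore (suc i) (update V (r ++ [ j ]) (V (r ++ [ j ]) ++ [ y ])) ×
    OnlyAdds y V (update V (r ++ [ j ]) (V (r ++ [ j ]) ++ [ y ]))
  bumping-append {i} {V} {r} {P} {x} {y} b j app =
    append-at V c wellFormed (bumping-supported b) yFresh app c-depth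
      (parent-of-child (λ q → Supports (V q) (V c ++ [ y ])) r j into-c)
    where
    open Bumping b
    c = r ++ [ j ]
    c-depth : length c ℕ.< suc i
    c-depth = subst (ℕ._< suc i) (sym (length-snoc r j)) (s≤s (bumping-depth b))
    into-c : Supports (V r) (V c ++ [ y ])
    into-c = subst (λ R → Supports R (V c ++ [ y ])) (sym row≡)
               (supports-append P (V c) oldIncreasing bumpedFrom x<y (supportedByOld j) (appendable⇒below (V c) app))

  bumping-bump : ∀ {i V r P x y z} → Bumping i V r P x y → ∀ j → LeastAbove y z (V (r ++ [ j ])) →
    Bumping i (update V (r ++ [ j ]) (replace z y (V (r ++ [ j ])))) (r ++ [ j ]) (V (r ++ [ j ])) y z ×
    OnlyAdds y V (update V (r ++ [ j ]) (replace z y (V (r ++ [ j ]))))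
  bumping-bump {i} {V} {r} {P} {x} {y} {z} b j l =
    bump-at V c wellFormed (bumping-supported b) yFresh l
      (parent-of-child (λ q → Supports (V q) (replace z y (V c))) r j into-c)
    where
    open Bumping b
    c = r ++ [ j ]
    into-c : Supports (V r) (replace z y (V c))
    into-c = subst (λ R → Supports R (replace z y (V c))) (sym row≡)
               (supports-bump P (V c) oldIncreasing bumpedFrom x<y (increasing wellFormed c) l (yFresh c) (supportedByOld j))

  heapStore-empty : HeapStore 0 emptyStore
  heapStore-empty = record
    { wellFormed = record { increasing = λ _ → [] ; unique = λ _ _ () ; shallow = λ _ () ; short = λ _ → z≤n }
    ; supported  = λ _ _ → [] }


-- The alphabet Σ_k is nonempty (k ≥ 1), so every row has a child.
module _ {k : ℕ} (letter : Fin k) where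

  bump-children : ∀ f {i V r P x y} → Bumping {k} i V r P x y → i ℕ.≤ f + length r →
    ∃ λ V′ → bump f y (children r) V ≡ just V′ × HeapStore (suc i) V′ × OnlyAdds y V V′
  bump-children zero b i≤r = ⊥-elim (ℕP.<-irrefl refl (ℕP.<-≤-trans (bumping-depth b) i≤r))
  bump-children (suc f) {i} {V} {r} {y = y} b i≤f+r
    with bump-step f y (children r) V (children⁺ r letter)
           (increasing (Bumping.wellFormed b)) (Bumping.yFresh b)
  ... | appended c c∈ app eq with children⁻ r c c∈
  ...   | j , refl = _ , eq , bumping-append b j app
  bump-children (suc f) {i} {V} {r} {y = y} b i≤f+r | bumped c z c∈ l eq with children⁻ r c c∈
  ...   | j , refl with bumping-bump b j l
  ...     | b′ , add with bump-children f b′ fuel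
    where
    fuel : i ℕ.≤ f + length (r ++ [ j ])
    fuel = subst (λ n → i ℕ.≤ f + n) (sym (length-snoc r j))
             (subst (i ℕ.≤_) (sym (ℕP.+-suc f (length r))) i≤f+r)
  ...       | V″ , eq′ , H , add′ = V″ , trans eq eq′ , H , onlyAdds-trans (member l) add add′

  insert : ∀ i {V x} → HeapStore {k} i V → (∀ q → x ∉ V q) →
    ∃ λ V′ → bump (suc i) x [ [] ] V ≡ just V′ × HeapStore (suc i) V′ × OnlyAdds x V V′
  insert i {V} {x} H fresh with bump-step i x [ [] ] V (here refl) (increasing (HeapStore.wellFormed H)) fresh
  ... | appended c (here refl) app eq =
    _ , eq , append-at V [] (HeapStore.wellFormed H) (HeapStore.supported H) fresh app (s≤s z≤n)
               (λ q j q∷j≡[] → ⊥-elim (snoc≢[] q j q∷j≡[]))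
  ... | bumped c y (here refl) l eq
    with bump-at V [] (HeapStore.wellFormed H) (HeapStore.supported H) fresh l
           (λ q j q∷j≡[] → ⊥-elim (snoc≢[] q j q∷j≡[]))
  ...   | b , add with bump-children i b (ℕP.≤-reflexive (sym (ℕP.+-identityʳ i)))
  ...     | V′ , eq′ , H′ , add′ = V′ , trans eq eq′ , H′ , onlyAdds-trans (member l) add add′

  run-correct : ∀ xs i (V : Store k) → HeapStore i V → Distinct xs → (∀ q {e} → e ∈ V q → e ∉ xs) →
    ∃ λ V′ → run i xs V ≡ just V′ × ∃ λ i′ → HeapStore i′ V′
  run-correct [] i V H _ _ = V , refl , i , H
  run-correct (x ∷ xs) i V H (x∉xs ∷ distinct) fresh with insert i H (λ q x∈ → fresh q x∈ (here refl))
  ... | V₁ , eq , H₁ , add with run-correct xs (suc i) V₁ H₁ distinct fresh₁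
    where
    fresh₁ : ∀ q {e} → e ∈ V₁ q → e ∉ xs
    fresh₁ q e∈ with add q e∈
    ... | inj₁ refl        = λ x∈xs → All.lookup x∉xs x∈xs refl
    ... | inj₂ (q′ , e∈V) = fresh q′ e∈V ∘ there
  ...   | V′ , eq′ , H′ = V′ , trans (cong (_>>= run (suc i) xs) eq) eq′ , H′


nth-∈ : ∀ W a {v} → nth W a ≡ just v → v ∈ W
nth-∈ (w ∷ W) zero    refl = here refl
nth-∈ (w ∷ W) (suc a) eq   = there (nth-∈ W a eq)

nth-length : ∀ W a {v} → nth W a ≡ just v → a ℕ.< length W
nth-length (w ∷ W) zero    refl = s≤s z≤n
nth-length (w ∷ W) (suc a) eq   = s≤s (nth-length W a eq)

nth-increasing : ∀ {W} → Increasing W → ∀ a b {v} → nth W a ≡ just v → b ℕ.< a →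
  ∃ λ u → nth W b ≡ just u × u < v
nth-increasing {w ∷ W} (w<W ∷ _) (suc a) zero    eq _         = w , refl , All.lookup w<W (nth-∈ W a eq)
nth-increasing {w ∷ W} (_ ∷ inc) (suc a) (suc b) eq (s≤s b<a) = nth-increasing inc a b eq b<a

nth-supports : ∀ {P W} → Supports P W → ∀ a {v} → nth W a ≡ just v → ∃ λ u → nth P a ≡ just u × u ≤ v
nth-supports (p≤w ∷ s) zero    refl = _ , refl , p≤w
nth-supports (p≤w ∷ s) (suc a) eq   = nth-supports s a eq

module _ {k : ℕ} where

  supported-descendant : ∀ {V : Store k} → Supported V → ∀ s q a {v} → nth (V (q ++ s)) a ≡ just v →
    ∃ λ u → nth (V q) a ≡ just u × u ≤ v
  supported-descendant {V} sup [] q a {v} eq =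
    v , subst (λ t → nth (V t) a ≡ just v) (++-identityʳ q) eq , ℤP.≤-refl
  supported-descendant {V} sup (j ∷ s) q a {v} eq
    with supported-descendant sup s (q ++ [ j ]) a (subst (λ t → nth (V t) a ≡ just v) (sym (++-assoc q [ j ] s)) eq)
  ... | u′ , eq′ , u′≤v with nth-supports (sup q j) a eq′
  ...   | u , eq″ , u≤u′ = u , eq″ , ℤP.≤-trans u≤u′ u′≤v

  words : ℕ → List (Addr k)
  words zero    = [ [] ]
  words (suc n) = cartesianProductWith _∷_ (allFin k) (words n)

  words-complete : ∀ (q : Addr k) → q ∈ words (length q)
  words-complete []      = here refl
  words-complete (j ∷ q) = ∈-cartesianProductWith⁺ _∷_ (∈-allFin j) (words-complete q)

  shorterThan : ℕ → List (Addr k)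
  shorterThan zero    = []
  shorterThan (suc n) = words n ++ shorterThan n

  shorterThan-complete : ∀ (q : Addr k) n → length q ℕ.< n → q ∈ shorterThan n
  shorterThan-complete q (suc n) (s≤s q≤n) with length q ℕP.≟ n
  ... | yes refl = ∈-++⁺ˡ (words-complete q)
  ... | no q≢n   = ∈-++⁺ʳ (words n) (shorterThan-complete q n (ℕP.≤∧≢⇒< q≤n q≢n))

  -- The invariant yields a k-heap tableau: its entries lie in rows of depth
  -- < i at positions ≤ i, giving the finite domain (a).
  heapStore⇒heapTableau : ∀ {i} {V : Store k} → HeapStore i V → IsHeapTableau (toTableau V)
  heapStore⇒heapTableau {i} {V} H = record { finiteDom = finiteDom ; heap = heap ; row = row }
    where
    open HeapStore H
    defined : ∀ r a → toTableau V r (suc a) ≢ nothing → ∃ λ v → nth (V r) a ≡ just v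
    defined r a ≢nothing with nth (V r) a
    ... | just v  = v , refl
    ... | nothing = ⊥-elim (≢nothing refl)
    finiteDom : ∃ λ D → ∀ r a → 1 ℕ.≤ a → toTableau V r a ≢ nothing → (r , a) ∈ D
    finiteDom = cartesianProduct (shorterThan i) (upTo (suc i)) , within
      where
      within : ∀ r a → 1 ℕ.≤ a → toTableau V r a ≢ nothing → (r , a) ∈ cartesianProduct (shorterThan i) (upTo (suc i))
      within r (suc a) _ ≢nothing with defined r a ≢nothing
      ... | v , eq = ∈-cartesianProduct⁺ (shorterThan-complete r i (shallow wellFormed r (nth-∈ (V r) a eq)))
                       (∈-upTo⁺ (s≤s (ℕP.<-≤-trans (nth-length (V r) a eq) (short wellFormed r))))
    heap : ∀ q r a v → 1 ℕ.≤ a → toTableau V r a ≡ just v → q ⊏ r →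
      ∃ λ u → (toTableau V q a ≡ just u) × (u ≤ v)
    heap q r (suc a) v _ eq (s , _ , q++s≡r) =
      supported-descendant supported s q a (subst (λ t → nth (V t) a ≡ just v) (sym q++s≡r) eq)
    row : ∀ r a b v → 1 ℕ.≤ b → b ℕ.< a → toTableau V r a ≡ just v →
      ∃ λ u → (toTableau V r b ≡ just u) × (u < v)
    row r (suc a) (suc b) v _ (s≤s b<a) eq = nth-increasing (increasing wellFormed r) a b eq b<a

theorem7 : (k : ℕ) → 1 ℕ.≤ k → (X : List ℤ) → Distinct X →
    ∃ λ (V : Store k) → (schenstedHeap k X ≡ just V) × IsHeapTableau (toTableau V)
theorem7 (suc k) (s≤s z≤n) X distinct
  with run-correct (Fin.zero {k}) X 0 emptyStore heapStore-empty distinct (λ _ ())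
... | V , ran , _ , H = V , ran , heapStore⇒heapTableau H
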